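{- If a cubic quadrangulation $G$ has an odd number of vertices, then, for a bipartition $A\cup B$ of $G$, one of the two classes contains exactly 6 vertices of degree 3 and the other contains exactly 2 vertices of degree 3.
   Context: A cubic quadrangulation is a cellular embedding of a (multi)graph $G$ in the sphere $S^2$ such that every vertex of $G$ has degree 3 or 4 and every face of the embedding is a quadrangle (boundary walk of length 4). Such a graph is bipartite, and has exactly 8 vertices of degree 3; $A\cup B$ denotes a bipartition of its vertex set. -}

module Defs where

open import Data.Nat using (ℕ; zero; suc; _+_; _*_; _%_)
open import Data.Fin using (Fin)
open import Data.Fin.Properties using () renaming (_≟_ to _≟ᶠ_)
open import Data.Fin.Permutation using (Permutation′; _⟨$⟩ʳ_)
open import Data.Bool using (Bool; true; false)
open import Data.Bool.Properties using () renaming (_≟_ to _≟ᵇ_)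
open import Data.List using (List; length; filter)
open import Data.List.Base using (allFin)
open import Data.Product using (Σ; ∃; _×_; _,_)
open import Data.Sum using (_⊎_)
open import Function using (_⇔_)
open import Relation.Nullary using (¬_)
open import Relation.Nullary.Decidable using (_×-dec_)
open import Relation.Binary.PropositionalEquality using (_≡_)

iter : ∀ {A : Set} → (A → A) → ℕ → A → A
iter f zero x = x
iter f (suc k) x = f (iter f k x)


-- A combinatorial map (rotation system) on D darts:
--   σ : rotation around vertices (vertices = σ-orbits),
--   α : fixed-point-free involution (edges = α-orbits),
--   φ = σ ∘ α : face permutation (faces = φ-orbits).
record Map : Set where
  field
    D : ℕ
    σ : Permutation′ D
    α : Permutation′ D
    α-invol : ∀ d → α ⟨$⟩ʳ (α ⟨$⟩ʳ d) ≡ d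
    α-nofix : ∀ d → ¬ (α ⟨$⟩ʳ d ≡ d)
    V : ℕ
    vertexOf : Fin D → Fin V
    vertexOf-surj : ∀ v → ∃ λ d → vertexOf d ≡ v
    vertexOf-orbit : ∀ d d' → (vertexOf d ≡ vertexOf d') ⇔ (∃ λ k → iter (σ ⟨$⟩ʳ_) k d ≡ d')
    F : ℕ
    faceOf : Fin D → Fin F
    faceOf-surj : ∀ f → ∃ λ d → faceOf d ≡ f
    faceOf-orbit : ∀ d d' → (faceOf d ≡ faceOf d') ⇔
                   (∃ λ k → iter (λ x → σ ⟨$⟩ʳ (α ⟨$⟩ʳ x)) k d ≡ d')

data Reach (M : Map) : Fin (Map.D M) → Fin (Map.D M) → Set where
  here  : ∀ {d} → Reach M d d
  stepσ : ∀ {d d'} → Reach M (Map.σ M ⟨$⟩ʳ d) d' → Reach M d d'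
  stepα : ∀ {d d'} → Reach M (Map.α M ⟨$⟩ʳ d) d' → Reach M d d'

Connected : Map → Set
Connected M = ∀ d d' → Reach M d d'

-- Euler characteristic 2: V - E + F = 2 with E = D/2, i.e. 2V + 2F = D + 4
Spherical : Map → Set
Spherical M = 2 * Map.V M + 2 * Map.F M ≡ Map.D M + 4

-- A cellular embedding of a (multi)graph in the sphere S²
SphereMap : Map → Set
SphereMap M = Connected M × Spherical M

deg : (M : Map) → Fin (Map.V M) → ℕ
deg M v = length (filter (λ d → Map.vertexOf M d ≟ᶠ v) (allFin (Map.D M)))

faceLen : (M : Map) → Fin (Map.F M) → ℕ
faceLen M f = length (filter (λ d → Map.faceOf M d ≟ᶠ f) (allFin (Map.D M)))

CubicQuadrangulation : Map → Set
CubicQuadrangulation M =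
  SphereMap M ×
  (∀ v → deg M v ≡ 3 ⊎ deg M v ≡ 4) ×
  (∀ f → faceLen M f ≡ 4)

-- a bipartition A ∪ B, given as a colouring (A = true, B = false)
-- such that the two ends of every edge lie in different classes
IsBipartition : (M : Map) → (Fin (Map.V M) → Bool) → Set
IsBipartition M c =
  ∀ d → ¬ (c (Map.vertexOf M d) ≡ c (Map.vertexOf M (Map.α M ⟨$⟩ʳ d)))

deg3In : (M : Map) → (Fin (Map.V M) → Bool) → Bool → ℕ
deg3In M c b =
  length (filter (λ v → (c v ≟ᵇ b) ×-dec (deg M v Data.Nat.≟ 3)) (allFin (Map.V M)))

module Submission where

-- Colour the vertices by the
-- bipartition A ∪ B and, for a colour class X, let tₓ be the number of darts
-- whose vertex lies in X and pₓ its number of degree-3 vertices.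
--   * Every vertex has degree 3 or 4, so 4|X| = tₓ + pₓ.
--   * The edge involution α swaps the two ends of each edge, hence maps the
--     darts at A bijectively onto the darts at B: t_A = t_B =: t, D = 2t.
--   * Every face is a quadrangle, so D = 4F; Euler (2V + 2F = D + 4) then
--     gives p_A + p_B = 8 (the eight degree-3 vertices of the context).
--   * 4|A| + p_B = 4|B| + p_A with |A| + |B| = V odd, so p_A and p_B differ
--     by an odd multiple of 4; together with p_A + p_B = 8 this leaves only
--     {p_A, p_B} = {6, 2}.

open import Defs
open import Data.Nat using (ℕ; zero; suc; _+_; _*_; _%_; _/_; _≟_)
open import Data.Nat.Properties
  using (+-*-semiring; suc-injective; +-comm; +-identityʳ; +-suc; +-cancelˡ-≡; *-cancelˡ-≡)
open import Data.Nat.DivMod using (m≡m%n+[m/n]*n)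
open import Data.Nat.Tactic.RingSolver using (solve)
open import Data.Bool using (Bool; true; false; if_then_else_)
open import Data.Bool.Properties using () renaming (_≟_ to _≟ᵇ_)
open import Data.Fin using (Fin; zero; suc)
open import Data.Fin.Properties using () renaming (_≟_ to _≟ᶠ_)
open import Data.Fin.Permutation using (_⟨$⟩ʳ_)
open import Data.List using ([]; _∷_; length; filter; tabulate)
open import Data.List.Base using (allFin)
open import Data.Product using (_×_; _,_; ∃; swap)
open import Data.Sum using (_⊎_; inj₁; inj₂; [_,_]′)
open import Data.Empty using (⊥-elim)
open import Function using (_∘_; id)
open import Relation.Nullary using (¬_; Dec; does; _because_)
open import Relation.Nullary.Decidable using (_×-dec_)
open import Relation.Unary using (Pred; Decidable)
open import Relation.Binary.PropositionalEquality
open import Algebra.Properties.Semiring.Sum +-*-semiring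
  using (sum-syntax; sum-cong-≗; sum-replicate-zero; ∑-comm; ∑-distrib-+;
         *-distribʳ-sum; sum-permute)

𝟙 : ∀ {p} {P : Set p} → Dec P → ℕ
𝟙 P? = if does P? then 1 else 0

count-as-sum : ∀ {a p} {A : Set a} {P : Pred A p} (P? : Decidable P) {n}
  (f : Fin n → A) → length (filter P? (tabulate f)) ≡ ∑[ i < n ] 𝟙 (P? (f i))
count-as-sum P? {zero} f = refl
count-as-sum P? {suc n} f with does (P? (f zero))
... | true  = cong suc (count-as-sum P? (f ∘ suc))
... | false = count-as-sum P? (f ∘ suc)

sum-delta : ∀ {n} (x : Fin n) (g : Fin n → ℕ) → ∑[ v < n ] (𝟙 (x ≟ᶠ v) * g v) ≡ g x
sum-delta {suc n} zero g = begin
  g zero + 0 + ∑[ v < n ] 0 ≡⟨ cong (g zero + 0 +_) (sum-replicate-zero n) ⟩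
  g zero + 0 + 0            ≡⟨ trans (+-identityʳ _) (+-identityʳ _) ⟩
  g zero                    ∎
  where open ≡-Reasoning
sum-delta {suc n} (suc x) g = sum-delta x (g ∘ suc)

fibre : ∀ {m n} → (Fin m → Fin n) → Fin n → ℕ
fibre {m} f v = length (filter (λ d → f d ≟ᶠ v) (allFin m))

double-count : ∀ {m n} (f : Fin m → Fin n) (g : Fin n → ℕ) →
  ∑[ d < m ] g (f d) ≡ ∑[ v < n ] (fibre f v * g v)
double-count {m} {n} f g = begin
  ∑[ d < m ] g (f d)
    ≡⟨ sum-cong-≗ (λ d → sym (sum-delta (f d) g)) ⟩
  ∑[ d < m ] ∑[ v < n ] (𝟙 (f d ≟ᶠ v) * g v)
    ≡⟨ ∑-comm (λ d v → 𝟙 (f d ≟ᶠ v) * g v) ⟩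
  ∑[ v < n ] ∑[ d < m ] (𝟙 (f d ≟ᶠ v) * g v)
    ≡⟨ sum-cong-≗ (λ v → sym (*-distribʳ-sum (g v) (λ d → 𝟙 (f d ≟ᶠ v)))) ⟩
  ∑[ v < n ] (∑[ d < m ] 𝟙 (f d ≟ᶠ v) * g v)
    ≡⟨ sum-cong-≗ (λ v → cong (_* g v) (sym (count-as-sum (λ d → f d ≟ᶠ v) {m} id))) ⟩
  ∑[ v < n ] (fibre f v * g v) ∎
  where open ≡-Reasoning

sum-ones : ∀ n → ∑[ i < n ] 1 ≡ n
sum-ones zero    = refl
sum-ones (suc n) = cong suc (sum-ones n)

count-split : ∀ n (h : Fin n → Bool) →
  n ≡ ∑[ i < n ] 𝟙 (h i ≟ᵇ true) + ∑[ i < n ] 𝟙 (h i ≟ᵇ false)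
count-split n h = begin
  n
    ≡⟨ sym (sum-ones n) ⟩
  ∑[ i < n ] 1
    ≡⟨ sum-cong-≗ (λ i → one-class (h i)) ⟩
  ∑[ i < n ] (𝟙 (h i ≟ᵇ true) + 𝟙 (h i ≟ᵇ false))
    ≡⟨ ∑-distrib-+ (λ i → 𝟙 (h i ≟ᵇ true)) (λ i → 𝟙 (h i ≟ᵇ false)) ⟩
  ∑[ i < n ] 𝟙 (h i ≟ᵇ true) + ∑[ i < n ] 𝟙 (h i ≟ᵇ false) ∎
  where
  open ≡-Reasoning
  one-class : ∀ x → 1 ≡ 𝟙 (x ≟ᵇ true) + 𝟙 (x ≟ᵇ false)
  one-class true  = refl
  one-class false = refl

module _ (M : Map) where
  open Map M

  dartsIn : (Fin V → Bool) → Bool → ℕ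
  dartsIn c b = ∑[ d < D ] 𝟙 (c (vertexOf d) ≟ᵇ b)

  classSize : (Fin V → Bool) → Bool → ℕ
  classSize c b = ∑[ v < V ] 𝟙 (c v ≟ᵇ b)

  -- If all degrees are 3 or 4, then 4|X| = (darts at X) + (degree-3 vertices
  -- of X) for each colour class X: a degree-3 vertex is one dart short of 4.
  class-degree-count : (∀ v → deg M v ≡ 3 ⊎ deg M v ≡ 4) → ∀ c b →
    dartsIn c b + deg3In M c b ≡ classSize c b * 4
  class-degree-count degs c b = begin
    dartsIn c b + deg3In M c b
      ≡⟨ cong₂ _+_ (double-count vertexOf inX) (count-as-sum deg3X? id) ⟩
    ∑[ v < V ] (deg M v * inX v) + ∑[ v < V ] 𝟙 (deg3X? v)
      ≡⟨ sym (∑-distrib-+ (λ v → deg M v * inX v) (λ v → 𝟙 (deg3X? v))) ⟩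
    ∑[ v < V ] (deg M v * inX v + 𝟙 (deg3X? v))
      ≡⟨ sum-cong-≗ (λ v → weight (c v ≟ᵇ b) (degs v)) ⟩
    ∑[ v < V ] (inX v * 4)
      ≡⟨ sym (*-distribʳ-sum 4 inX) ⟩
    classSize c b * 4 ∎
    where
    open ≡-Reasoning
    inX : Fin V → ℕ
    inX v = 𝟙 (c v ≟ᵇ b)
    deg3X? : Decidable (λ v → c v ≡ b × deg M v ≡ 3)
    deg3X? v = (c v ≟ᵇ b) ×-dec (deg M v ≟ 3)
    weight : ∀ {X : Set} (X? : Dec X) {n} → n ≡ 3 ⊎ n ≡ 4 →
      n * 𝟙 X? + 𝟙 (X? ×-dec (n ≟ 3)) ≡ 𝟙 X? * 4
    weight (true  because _) (inj₁ refl) = refl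
    weight (true  because _) (inj₂ refl) = refl
    weight (false because _) (inj₁ refl) = refl
    weight (false because _) (inj₂ refl) = refl

  -- In a bipartition the edge involution α maps the darts at A bijectively
  -- onto the darts at B, so both classes carry the same number of darts.
  bipartite-balanced : ∀ c → IsBipartition M c → dartsIn c true ≡ dartsIn c false
  bipartite-balanced c bip = begin
    dartsIn c true
      ≡⟨ sum-cong-≗ (λ d → opposite (bip d)) ⟩
    ∑[ d < D ] 𝟙 (c (vertexOf (α ⟨$⟩ʳ d)) ≟ᵇ false)
      ≡⟨ sym (sum-permute (λ d → 𝟙 (c (vertexOf d) ≟ᵇ false)) α) ⟩
    dartsIn c false ∎
    where
    open ≡-Reasoning
    opposite : ∀ {x y} → ¬ x ≡ y → 𝟙 (x ≟ᵇ true) ≡ 𝟙 (y ≟ᵇ false)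
    opposite {true}  {true}  x≢y = ⊥-elim (x≢y refl)
    opposite {true}  {false} _   = refl
    opposite {false} {true}  _   = refl
    opposite {false} {false} x≢y = ⊥-elim (x≢y refl)

  -- Each dart lies on exactly one face, so if all faces are quadrangles the
  -- darts come in groups of four: D = 4F.
  quadrangulation-darts : (∀ f → faceLen M f ≡ 4) → D ≡ F * 4
  quadrangulation-darts quads = begin
    D                              ≡⟨ sym (sum-ones D) ⟩
    ∑[ d < D ] 1                   ≡⟨ double-count faceOf (λ _ → 1) ⟩
    ∑[ f < F ] (faceLen M f * 1)   ≡⟨ sum-cong-≗ (λ f → cong (_* 1) (quads f)) ⟩
    ∑[ f < F ] (1 * 4)             ≡⟨ sym (*-distribʳ-sum {F} 4 (λ _ → 1)) ⟩
    (∑[ f < F ] 1) * 4             ≡⟨ cong (_* 4) (sum-ones F) ⟩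
    F * 4                          ∎
    where open ≡-Reasoning

-- Euler's formula forces exactly eight vertices of degree 3: with
-- 4|A| = t + p, 4|B| = t + q, D = 2t = 4F and 2V + 2F = D + 4,
-- counting 4V + 4F in two ways gives p + q = 8.
eight-degree-three : ∀ t p q a b F {V D} →
  t + p ≡ a * 4 → t + q ≡ b * 4 → V ≡ a + b → D ≡ t + t → D ≡ F * 4 →
  2 * V + 2 * F ≡ D + 4 → p + q ≡ 8
eight-degree-three t p q a b F tp tq refl refl tF euler =
  +-cancelˡ-≡ (t + t + (t + t)) (p + q) 8 (begin
    t + t + (t + t) + (p + q)    ≡⟨ solve (t ∷ p ∷ q ∷ []) ⟩
    (t + p) + (t + q) + (t + t)  ≡⟨ cong₂ _+_ (cong₂ _+_ tp tq) tF ⟩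
    a * 4 + b * 4 + F * 4        ≡⟨ solve (a ∷ b ∷ F ∷ []) ⟩
    2 * (2 * (a + b) + 2 * F)    ≡⟨ cong (2 *_) euler ⟩
    2 * (t + t + 4)              ≡⟨ solve (t ∷ []) ⟩
    t + t + (t + t) + 8          ∎)
  where open ≡-Reasoning

trade-difference : ∀ t p q a b → t + p ≡ a * 4 → t + q ≡ b * 4 → a * 4 + q ≡ b * 4 + p
trade-difference t p q a b tp tq = begin
  a * 4 + q    ≡⟨ cong (_+ q) (sym tp) ⟩
  t + p + q    ≡⟨ solve (t ∷ p ∷ q ∷ []) ⟩
  t + q + p    ≡⟨ cong (_+ p) tq ⟩
  b * 4 + p    ∎
  where open ≡-Reasoning

-- If 4a + q = 4b + p and a + b is odd, then p and q differ by an odd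
-- multiple of 4 (cancel 4 from both sides while a and b are positive).
odd-multiple-of-four : ∀ a b k {p q} → a * 4 + q ≡ b * 4 + p → a + b ≡ suc (k * 2) →
  (∃ λ j → q ≡ suc (j * 2) * 4 + p) ⊎ (∃ λ j → p ≡ suc (j * 2) * 4 + q)
odd-multiple-of-four zero    b       k e refl = inj₁ (k , e)
odd-multiple-of-four (suc a) zero    k {p} {q} e odd =
  inj₂ (k , subst (λ n → p ≡ n * 4 + q) (trans (sym (+-identityʳ (suc a))) odd) (sym e))
odd-multiple-of-four (suc a) (suc b) zero e odd
  with () ← trans (cong suc (sym (+-suc a b))) odd
odd-multiple-of-four (suc a) (suc b) (suc k) e odd =
  odd-multiple-of-four a b k (+-cancelˡ-≡ 4 _ _ e)
    (suc-injective (suc-injective (trans (cong suc (sym (+-suc a b))) odd)))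

-- If the degree-3 counts add up to 8 and differ by an odd multiple of 4,
-- they are 2 and 6 (a difference of 12 or more would already exceed 8).
two-and-six : ∀ {p q} → (∃ λ j → q ≡ suc (j * 2) * 4 + p) → q + p ≡ 8 → p ≡ 2 × q ≡ 6
two-and-six {p} (zero , refl) 4+2p≡8 = p≡2 , cong (4 +_) p≡2
  where
  p≡2 : p ≡ 2
  p≡2 = *-cancelˡ-≡ p 2 2 (begin
    2 * p   ≡⟨ solve (p ∷ []) ⟩
    p + p   ≡⟨ +-cancelˡ-≡ 4 (p + p) 4 4+2p≡8 ⟩
    4       ∎)
    where open ≡-Reasoning
two-and-six (suc j , refl) ()

corollary3p3 : (M : Map) → CubicQuadrangulation M → Map.V M % 2 ≡ 1 →
    (c : Fin (Map.V M) → Bool) → IsBipartition M c →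
    (deg3In M c true ≡ 6 × deg3In M c false ≡ 2) ⊎
    (deg3In M c true ≡ 2 × deg3In M c false ≡ 6)
corollary3p3 M ((_ , euler) , degs , quads) V-odd c bip =
  [ (λ q-above-p → inj₂ (two-and-six q-above-p (trans (+-comm q p) p+q≡8)))
  , (λ p-above-q → inj₁ (swap (two-and-six p-above-q p+q≡8)))
  ]′ (odd-multiple-of-four a b (V / 2) 4a+q≡4b+p a+b-odd)
  where
  open Map M
  t p q a b : ℕ
  t = dartsIn M c true
  p = deg3In M c true
  q = deg3In M c false
  a = classSize M c true
  b = classSize M c false
  balanced : t ≡ dartsIn M c false
  balanced = bipartite-balanced M c bip
  t+p≡4a : t + p ≡ a * 4
  t+p≡4a = class-degree-count M degs c true
  t+q≡4b : t + q ≡ b * 4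
  t+q≡4b = trans (cong (_+ q) balanced) (class-degree-count M degs c false)
  V≡a+b : V ≡ a + b
  V≡a+b = count-split V c
  D≡t+t : D ≡ t + t
  D≡t+t = trans (count-split D (c ∘ vertexOf)) (cong (t +_) (sym balanced))
  p+q≡8 : p + q ≡ 8
  p+q≡8 = eight-degree-three t p q a b F t+p≡4a t+q≡4b V≡a+b D≡t+t
            (quadrangulation-darts M quads) euler
  4a+q≡4b+p : a * 4 + q ≡ b * 4 + p
  4a+q≡4b+p = trade-difference t p q a b t+p≡4a t+q≡4b
  a+b-odd : a + b ≡ suc (V / 2 * 2)
  a+b-odd = trans (sym V≡a+b) (trans (m≡m%n+[m/n]*n V 2) (cong (_+ V / 2 * 2) V-odd))
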